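{- For all integers $m,n\ge 1$, \begin{align*} T_{2m-1,n}(q)&=\sum_{r=0}^{m-1}(-1)^{n+r+1}\binom{2m-1}{r}\frac{(1-q^{m-r-\frac12})q^{(m-\frac12)n}}{(1-q)^{2m-1}(1+q^{m-r-\frac12})}\\ &\quad+\sum_{r=0}^{m-1}(-1)^r\binom{2m-1}{r}\frac{(1-q^{(2n+1)(m-r-\frac12)})q^{rn}}{(1-q)^{2m-1}(1+q^{m-r-\frac12})}. \end{align*}
   Context: $q$ is an indeterminate and identities are identities of rational functions in $q^{1/2}$. For positive integers $m,n$, \[ T_{m,n}(q)=\sum_{k=1}^{n}(-1)^{n-k}\left(\frac{1-q^k}{1-q}\right)^{m}q^{\frac{m}{2}(n-k)}. \] -}

module Defs where

open import Data.Nat as ℕ using (ℕ; zero; suc; _∸_)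
open import Data.Nat.Combinatorics using (_C_)
open import Data.Integer using (+_)
open import Data.Rational using (ℚ; 0ℚ; 1ℚ; _+_; _*_; -_; _-_; _÷_; ≢-nonZero)
open import Data.Rational.Properties using (_≟_)
open import Relation.Nullary using (yes; no)

infixr 8 _^_
_^_ : ℚ → ℕ → ℚ
x ^ zero  = 1ℚ
x ^ suc n = x * x ^ n

ℕ→ℚ : ℕ → ℚ
ℕ→ℚ n = Data.Rational._/_ (+ n) 1

-- total division: p / q for q ≠ 0 (junk value 0 when q = 0; the
-- statement only uses it under hypotheses making every divisor nonzero)
infixl 7 _/'_
_/'_ : ℚ → ℚ → ℚ
p /' q with q ≟ 0ℚ
... | yes _  = 0ℚ
... | no q≢0 = _÷_ p q {{≢-nonZero q≢0}}

-- Σ[ i = a .. b ] f i  (inclusive; empty when b < a)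
ΣFromTo : ℕ → ℕ → (ℕ → ℚ) → ℚ
ΣFromTo a b f = go (suc b ∸ a)
  where
  go : ℕ → ℚ
  go zero    = 0ℚ
  go (suc j) = go j + f (a ℕ.+ j)

-- T_{m,n}(q) evaluated at q = t², i.e. t plays the role of q^{1/2}:
--   Σ_{k=1}^{n} (-1)^{n-k} ((1 - q^k)/(1 - q))^m q^{m(n-k)/2}
T : ℕ → ℕ → ℚ → ℚ
T m n t = ΣFromTo 1 n λ k →
  (- 1ℚ) ^ (n ∸ k)
    * ((1ℚ - t ^ (2 ℕ.* k)) /' (1ℚ - t ^ 2)) ^ m
    * t ^ (m ℕ.* (n ∸ k))

-- Write q = t², M = 2m - 1 and c = 1/(1 - q).  Both sides, as functions of n, solve
--   x(n+1) = -t^M x(n) + c^M (1 - q^(n+1))^M,   x(0) = 0;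
-- for T this is read off its definition.  On the right, the two summands with index r combine to
-- (-1)^r C(M,r) c^M N_n / (1 + u), where u = t^(M-2r), a = q^r and
--   N_n = a^n (1 - u^(2n+1) - (-u)^n (1 - u))   satisfies   N_(n+1) + u a N_n = (1 + u) a^(n+1) (1 - u^(2n+2)).
-- Since u a = t^M, the inhomogeneous terms add up to c^M Σ_r C(M,r) (-z)^r (1 - z^(M-2r)) with
-- z = q^(n+1), which is (1 - z)^M: as M is odd, the binomial terms j = r and j = M - r pair up.

{-# OPTIONS --safe #-}
module Submission where

open import Algebra.Bundles using (CommutativeMonoid; CommutativeRing; CommutativeSemiring)
import Algebra.Properties.CommutativeSemigroup as CommutativeSemigroup
import Algebra.Properties.CommutativeSemiring.Binomial as Binomial
import Algebra.Properties.CommutativeSemiring.Exp as Exp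
import Algebra.Properties.Semiring.Mult as Mult
import Algebra.Properties.Semiring.Sum as Sum
open import Data.Fin.Base using (toℕ)
import Data.Integer.Base as ℤ
import Data.Integer.Properties as ℤₚ
open import Data.Nat as ℕ using (ℕ; zero; suc; _<_; _≤_; _≥_; _∸_)
open import Data.Nat.Combinatorics using (_C_; nCk≡nC[n∸k])
import Data.Nat.Coprimality as Coprime
import Data.Nat.Properties as ℕₚ
import Data.Nat.Tactic.RingSolver as ℕ-Solver
open import Data.Product using (_,_)
open import Data.Rational using (ℚ; 0ℚ; 1ℚ; _+_; _*_; -_; _-_; _/_; mkℚ; ≢-nonZero)
import Data.Rational.Properties as ℚₚ
open import Data.Rational.Solver using (module +-*-Solver)
open import Level using (0ℓ)
open import Relation.Binary.PropositionalEquality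
open import Relation.Nullary.Decidable using (yes; no)
open import Relation.Nullary.Negation using (contradiction)
open import Defs

open +-*-Solver using (solve; _:=_; con; _:+_; _:*_; :-_; _:-_)
open ≡-Reasoning

private
  ℚ-commutativeSemiring : CommutativeSemiring 0ℓ 0ℓ
  ℚ-commutativeSemiring = CommutativeRing.commutativeSemiring ℚₚ.+-*-commutativeRing

  module +-CS = CommutativeSemigroup (CommutativeMonoid.commutativeSemigroup ℚₚ.+-0-commutativeMonoid)
  module *-CS = CommutativeSemigroup (CommutativeMonoid.commutativeSemigroup ℚₚ.*-1-commutativeMonoid)
  module ℚ-Exp = Exp ℚ-commutativeSemiring
  module ℚ-Binomial = Binomial ℚ-commutativeSemiring
  module ℚ-Mult = Mult (CommutativeSemiring.semiring ℚ-commutativeSemiring)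
  module ℚ-Sum = Sum (CommutativeSemiring.semiring ℚ-commutativeSemiring)

recip : ℚ → ℚ
recip y = 1ℚ /' y

/'-≡-*-recip : ∀ x y → x /' y ≡ x * recip y
/'-≡-*-recip x y with y ℚₚ.≟ 0ℚ
... | yes _ = sym (ℚₚ.*-zeroʳ x)
... | no _  = cong (x *_) (sym (ℚₚ.*-identityˡ _))

*-recip : ∀ y → y ≢ 0ℚ → y * recip y ≡ 1ℚ
*-recip y y≢0 with y ℚₚ.≟ 0ℚ
... | yes y≡0  = contradiction y≡0 y≢0
... | no  y≢0′ = trans (cong (y *_) (ℚₚ.*-identityˡ _)) (ℚₚ.*-inverseʳ y {{≢-nonZero y≢0′}})

recip-unique : ∀ y z → y * z ≡ 1ℚ → recip y ≡ z
recip-unique y z yz≡1 = begin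
  recip y            ≡⟨ sym (ℚₚ.*-identityʳ (recip y)) ⟩
  recip y * 1ℚ       ≡⟨ cong (recip y *_) (sym yz≡1) ⟩
  recip y * (y * z)  ≡⟨ *-CS.x∙yz≈yx∙z (recip y) y z ⟩
  y * recip y * z    ≡⟨ cong (_* z) (*-recip y y≢0) ⟩
  1ℚ * z             ≡⟨ ℚₚ.*-identityˡ z ⟩
  z                  ∎
  where
  0≢1 : 0ℚ ≢ 1ℚ
  0≢1 ()
  y≢0 : y ≢ 0ℚ
  y≢0 refl = 0≢1 (trans (sym (ℚₚ.*-zeroˡ z)) yz≡1)

^≡ℚ-Exp^ : ∀ x n → x ^ n ≡ x ℚ-Exp.^ n
^≡ℚ-Exp^ x zero    = refl
^≡ℚ-Exp^ x (suc n) = cong (x *_) (^≡ℚ-Exp^ x n)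

^-homo-* : ∀ x m n → x ^ (m ℕ.+ n) ≡ x ^ m * x ^ n
^-homo-* x m n = begin
  x ^ (m ℕ.+ n)              ≡⟨ ^≡ℚ-Exp^ x (m ℕ.+ n) ⟩
  x ℚ-Exp.^ (m ℕ.+ n)        ≡⟨ ℚ-Exp.^-homo-* x m n ⟩
  x ℚ-Exp.^ m * x ℚ-Exp.^ n  ≡⟨ sym (cong₂ _*_ (^≡ℚ-Exp^ x m) (^≡ℚ-Exp^ x n)) ⟩
  x ^ m * x ^ n              ∎

^-assocʳ : ∀ x m n → (x ^ m) ^ n ≡ x ^ (m ℕ.* n)
^-assocʳ x m n = begin
  (x ^ m) ^ n              ≡⟨ ^≡ℚ-Exp^ (x ^ m) n ⟩
  (x ^ m) ℚ-Exp.^ n        ≡⟨ cong (ℚ-Exp._^ n) (^≡ℚ-Exp^ x m) ⟩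
  (x ℚ-Exp.^ m) ℚ-Exp.^ n  ≡⟨ ℚ-Exp.^-assocʳ x m n ⟩
  x ℚ-Exp.^ (m ℕ.* n)      ≡⟨ sym (^≡ℚ-Exp^ x (m ℕ.* n)) ⟩
  x ^ (m ℕ.* n)            ∎

^-distrib-* : ∀ x y n → (x * y) ^ n ≡ x ^ n * y ^ n
^-distrib-* x y n = begin
  (x * y) ^ n                ≡⟨ ^≡ℚ-Exp^ (x * y) n ⟩
  (x * y) ℚ-Exp.^ n          ≡⟨ ℚ-Exp.^-distrib-* x y n ⟩
  x ℚ-Exp.^ n * y ℚ-Exp.^ n  ≡⟨ sym (cong₂ _*_ (^≡ℚ-Exp^ x n) (^≡ℚ-Exp^ y n)) ⟩
  x ^ n * y ^ n              ∎

1^n≡1 : ∀ n → 1ℚ ^ n ≡ 1ℚ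
1^n≡1 zero    = refl
1^n≡1 (suc n) = trans (cong (1ℚ *_) (1^n≡1 n)) (ℚₚ.*-identityˡ 1ℚ)

^-2n+1 : ∀ x n → x ^ (2 ℕ.* n ℕ.+ 1) ≡ x * x ^ (2 ℕ.* n)
^-2n+1 x n = cong (x ^_) (ℕₚ.+-comm (2 ℕ.* n) 1)

^-2[1+n] : ∀ x n → x ^ (2 ℕ.* suc n) ≡ x * (x * x ^ (2 ℕ.* n))
^-2[1+n] x n = cong (x ^_) (ℕₚ.*-suc 2 n)

neg-^ : ∀ x n → (- x) ^ n ≡ (- 1ℚ) ^ n * x ^ n
neg-^ x n = trans (cong (_^ n) -x≡-1*x) (^-distrib-* (- 1ℚ) x n)
  where
  -x≡-1*x : - x ≡ - 1ℚ * x
  -x≡-1*x = trans (cong -_ (sym (ℚₚ.*-identityˡ x))) (ℚₚ.neg-distribˡ-* 1ℚ x)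

neg-^-odd : ∀ x d → (- x) ^ suc (2 ℕ.* d) ≡ - (x ^ suc (2 ℕ.* d))
neg-^-odd x d = begin
  - x * (- x) ^ (2 ℕ.* d)    ≡⟨ cong (- x *_) (sym (^-assocʳ (- x) 2 d)) ⟩
  - x * ((- x) ^ 2) ^ d      ≡⟨ cong (λ y → - x * y ^ d) (square x) ⟩
  - x * (x ^ 2) ^ d          ≡⟨ cong (- x *_) (^-assocʳ x 2 d) ⟩
  - x * x ^ (2 ℕ.* d)        ≡⟨ ℚₚ.neg-distribˡ-* x (x ^ (2 ℕ.* d)) ⟨
  - (x * x ^ (2 ℕ.* d))      ∎
  where
  square : ∀ x → - x * (- x * 1ℚ) ≡ x * (x * 1ℚ)
  square = solve 1 (λ x → :- x :* (:- x :* con 1ℚ) := x :* (x :* con 1ℚ)) refl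

recip-^-* : ∀ x y n → x ≢ 0ℚ → y ≢ 0ℚ → recip (x ^ n * y) ≡ recip x ^ n * recip y
recip-^-* x y n x≢0 y≢0 = recip-unique (x ^ n * y) _ (begin
  x ^ n * y * (recip x ^ n * recip y)    ≡⟨ *-CS.interchange (x ^ n) y (recip x ^ n) (recip y) ⟩
  x ^ n * recip x ^ n * (y * recip y)    ≡⟨ cong₂ _*_ (sym (^-distrib-* x (recip x) n)) (*-recip y y≢0) ⟩
  (x * recip x) ^ n * 1ℚ                 ≡⟨ cong (λ w → w ^ n * 1ℚ) (*-recip x x≢0) ⟩
  1ℚ ^ n * 1ℚ                            ≡⟨ cong (_* 1ℚ) (1^n≡1 n) ⟩
  1ℚ * 1ℚ                                ≡⟨ ℚₚ.*-identityˡ 1ℚ ⟩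
  1ℚ                                     ∎)

Σ< : ℕ → (ℕ → ℚ) → ℚ
Σ< zero    f = 0ℚ
Σ< (suc n) f = Σ< n f + f n

ΣFromTo-0≡Σ< : ∀ {m} → 1 ≤ m → ∀ f → ΣFromTo 0 (m ∸ 1) f ≡ Σ< m f
ΣFromTo-0≡Σ< {suc m} _ f = go m
  where
  go : ∀ b → ΣFromTo 0 b f ≡ Σ< (suc b) f
  go zero    = refl
  go (suc b) = cong (_+ f (suc b)) (go b)

ΣFromTo-1≡Σ< : ∀ n f → ΣFromTo 1 n f ≡ Σ< n (λ i → f (suc i))
ΣFromTo-1≡Σ< zero    f = refl
ΣFromTo-1≡Σ< (suc n) f = cong (_+ f (suc n)) (ΣFromTo-1≡Σ< n f)

Σ<-cong : ∀ n {f g} → (∀ i → i < n → f i ≡ g i) → Σ< n f ≡ Σ< n g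
Σ<-cong zero    f≡g = refl
Σ<-cong (suc n) f≡g =
  cong₂ _+_ (Σ<-cong n (λ i i<n → f≡g i (ℕₚ.m<n⇒m<1+n i<n))) (f≡g n (ℕₚ.n<1+n n))

Σ<-0 : ∀ n → Σ< n (λ _ → 0ℚ) ≡ 0ℚ
Σ<-0 zero    = refl
Σ<-0 (suc n) = trans (ℚₚ.+-identityʳ _) (Σ<-0 n)

Σ<-distrib-+ : ∀ n f g → Σ< n (λ i → f i + g i) ≡ Σ< n f + Σ< n g
Σ<-distrib-+ zero    f g = refl
Σ<-distrib-+ (suc n) f g = trans (cong (_+ (f n + g n)) (Σ<-distrib-+ n f g))
  (+-CS.interchange (Σ< n f) (Σ< n g) (f n) (g n))

*-distribˡ-Σ< : ∀ n x f → x * Σ< n f ≡ Σ< n (λ i → x * f i)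
*-distribˡ-Σ< zero    x f = ℚₚ.*-zeroʳ x
*-distribˡ-Σ< (suc n) x f =
  trans (ℚₚ.*-distribˡ-+ x (Σ< n f) (f n)) (cong (_+ x * f n) (*-distribˡ-Σ< n x f))

Σ<-front : ∀ n f → Σ< (suc n) f ≡ f 0 + Σ< n (λ i → f (suc i))
Σ<-front zero    f = ℚₚ.+-comm 0ℚ (f 0)
Σ<-front (suc n) f = trans (cong (_+ f (suc n)) (Σ<-front n f)) (ℚₚ.+-assoc (f 0) _ _)

Σ<-split : ∀ a b f → Σ< (a ℕ.+ b) f ≡ Σ< a f + Σ< b (λ i → f (a ℕ.+ i))
Σ<-split a zero    f = trans (cong (λ k → Σ< k f) (ℕₚ.+-identityʳ a)) (sym (ℚₚ.+-identityʳ _))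
Σ<-split a (suc b) f = begin
  Σ< (a ℕ.+ suc b) f                                 ≡⟨ cong (λ k → Σ< k f) (ℕₚ.+-suc a b) ⟩
  Σ< (a ℕ.+ b) f + f (a ℕ.+ b)                       ≡⟨ cong (_+ f (a ℕ.+ b)) (Σ<-split a b f) ⟩
  Σ< a f + Σ< b (λ i → f (a ℕ.+ i)) + f (a ℕ.+ b)    ≡⟨ ℚₚ.+-assoc (Σ< a f) _ _ ⟩
  Σ< a f + Σ< (suc b) (λ i → f (a ℕ.+ i))            ∎

Σ<-reverse : ∀ n f → Σ< n f ≡ Σ< n (λ i → f (n ∸ suc i))
Σ<-reverse zero    f = refl
Σ<-reverse (suc n) f = begin
  Σ< n f + f n                                ≡⟨ cong (_+ f n) (Σ<-reverse n f) ⟩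
  Σ< n (λ i → f (n ∸ suc i)) + f n            ≡⟨ ℚₚ.+-comm _ (f n) ⟩
  f n + Σ< n (λ i → f (n ∸ suc i))            ≡⟨ Σ<-front n (λ i → f (suc n ∸ suc i)) ⟨
  Σ< (suc n) (λ i → f (suc n ∸ suc i))        ∎

Σ<-fold-in-half : ∀ n f → Σ< (n ℕ.+ n) f ≡ Σ< n (λ i → f i + f (n ℕ.+ (n ∸ suc i)))
Σ<-fold-in-half n f = begin
  Σ< (n ℕ.+ n) f                                   ≡⟨ Σ<-split n n f ⟩
  Σ< n f + Σ< n (λ i → f (n ℕ.+ i))                ≡⟨ cong (Σ< n f +_) (Σ<-reverse n (λ i → f (n ℕ.+ i))) ⟩
  Σ< n f + Σ< n (λ i → f (n ℕ.+ (n ∸ suc i)))      ≡⟨ Σ<-distrib-+ n f _ ⟨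
  Σ< n (λ i → f i + f (n ℕ.+ (n ∸ suc i)))         ∎

ℕ→ℚ-suc : ∀ n → ℕ→ℚ (suc n) ≡ 1ℚ + ℕ→ℚ n
ℕ→ℚ-suc n = begin
  ℕ→ℚ (suc n)                                   ≡⟨ cong (_/ 1) [1+n]≡1*1+n*1 ⟩
  (ℤ.+ 1 ℤ.* ℤ.+ 1 ℤ.+ ℤ.+ n ℤ.* ℤ.+ 1) / 1     ≡⟨⟩
  1ℚ + mkℚ (ℤ.+ n) 0 n-coprime-1                 ≡⟨ cong (1ℚ +_) (ℚₚ.normalize-coprime n-coprime-1) ⟨
  1ℚ + ℕ→ℚ n                                     ∎
  where
  n-coprime-1 : Coprime.Coprime n 1
  n-coprime-1 = Coprime.sym (Coprime.1-coprimeTo n)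
  [1+n]≡1*1+n*1 : ℤ.+ suc n ≡ ℤ.+ 1 ℤ.* ℤ.+ 1 ℤ.+ ℤ.+ n ℤ.* ℤ.+ 1
  [1+n]≡1*1+n*1 = cong (λ k → ℤ.+ 1 ℤ.+ k) (sym (ℤₚ.*-identityʳ (ℤ.+ n)))

×≡ℕ→ℚ* : ∀ n x → n ℚ-Mult.× x ≡ ℕ→ℚ n * x
×≡ℕ→ℚ* zero    x = sym (ℚₚ.*-zeroˡ x)
×≡ℕ→ℚ* (suc n) x = begin
  x + n ℚ-Mult.× x      ≡⟨ cong (x +_) (×≡ℕ→ℚ* n x) ⟩
  x + ℕ→ℚ n * x         ≡⟨ 1+ x (ℕ→ℚ n) ⟩
  (1ℚ + ℕ→ℚ n) * x      ≡⟨ cong (_* x) (ℕ→ℚ-suc n) ⟨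
  ℕ→ℚ (suc n) * x       ∎
  where
  1+ : ∀ x k → x + k * x ≡ (1ℚ + k) * x
  1+ = solve 2 (λ x k → x :+ k :* x := (con 1ℚ :+ k) :* x) refl

sum≡Σ< : ∀ n (f : ℕ → ℚ) → ℚ-Sum.sum {n} (λ i → f (toℕ i)) ≡ Σ< n f
sum≡Σ< zero    f = refl
sum≡Σ< (suc n) f = trans (cong (f 0 +_) (sum≡Σ< n (λ i → f (suc i)))) (sym (Σ<-front n f))

binomial : ∀ n z → (1ℚ - z) ^ n ≡ Σ< (suc n) (λ k → ℕ→ℚ (n C k) * (- z) ^ k)
binomial n z = begin
  (1ℚ - z) ^ n                              ≡⟨ cong (_^ n) (ℚₚ.+-comm 1ℚ (- z)) ⟩
  (- z + 1ℚ) ^ n                            ≡⟨ ^≡ℚ-Exp^ (- z + 1ℚ) n ⟩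
  (- z + 1ℚ) ℚ-Exp.^ n                      ≡⟨ ℚ-Binomial.theorem n (- z) 1ℚ ⟩
  ℚ-Binomial.binomialExpansion (- z) 1ℚ n   ≡⟨ sum≡Σ< (suc n) term ⟩
  Σ< (suc n) term                           ≡⟨ Σ<-cong (suc n) (λ k _ → term≡ k) ⟩
  Σ< (suc n) (λ k → ℕ→ℚ (n C k) * (- z) ^ k) ∎
  where
  term : ℕ → ℚ
  term k = (n C k) ℚ-Mult.× ((- z) ℚ-Exp.^ k * 1ℚ ℚ-Exp.^ (n ∸ k))
  term≡ : ∀ k → term k ≡ ℕ→ℚ (n C k) * (- z) ^ k
  term≡ k = begin
    term k                                                ≡⟨ ×≡ℕ→ℚ* (n C k) _ ⟩
    ℕ→ℚ (n C k) * ((- z) ℚ-Exp.^ k * 1ℚ ℚ-Exp.^ (n ∸ k))  ≡⟨ cong₂ (λ v w → ℕ→ℚ (n C k) * (v * w))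
                                                              (sym (^≡ℚ-Exp^ (- z) k))
                                                              (trans (sym (^≡ℚ-Exp^ 1ℚ (n ∸ k))) (1^n≡1 (n ∸ k))) ⟩
    ℕ→ℚ (n C k) * ((- z) ^ k * 1ℚ)                        ≡⟨ cong (ℕ→ℚ (n C k) *_) (ℚₚ.*-identityʳ _) ⟩
    ℕ→ℚ (n C k) * (- z) ^ k                               ∎

[a+b]Ca≡[a+b]Cb : ∀ a b → (a ℕ.+ b) C a ≡ (a ℕ.+ b) C b
[a+b]Ca≡[a+b]Cb a b = trans (nCk≡nC[n∸k] (ℕₚ.m≤m+n a b)) (cong ((a ℕ.+ b) C_) (ℕₚ.m+n∸m≡n a b))

1+[2m∸1]≡m+m : ∀ {m} → 1 ≤ m → suc (2 ℕ.* m ∸ 1) ≡ m ℕ.+ m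
1+[2m∸1]≡m+m {suc m} _ = reduced m
  where
  reduced : ∀ m → suc (m ℕ.+ suc (m ℕ.+ 0)) ≡ suc m ℕ.+ suc m
  reduced = ℕ-Solver.solve-∀

2[1+r+d]∸2r∸1≡1+2d : ∀ r d → 2 ℕ.* suc (r ℕ.+ d) ∸ 2 ℕ.* r ∸ 1 ≡ suc (2 ℕ.* d)
2[1+r+d]∸2r∸1≡1+2d r d = cong (_∸ 1) (begin
  2 ℕ.* suc (r ℕ.+ d) ∸ 2 ℕ.* r               ≡⟨ cong (_∸ 2 ℕ.* r) (expand r d) ⟩
  2 ℕ.* r ℕ.+ suc (suc (2 ℕ.* d)) ∸ 2 ℕ.* r   ≡⟨ ℕₚ.m+n∸m≡n (2 ℕ.* r) _ ⟩
  suc (suc (2 ℕ.* d))                         ∎)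
  where
  expand : ∀ r d → 2 ℕ.* suc (r ℕ.+ d) ≡ 2 ℕ.* r ℕ.+ suc (suc (2 ℕ.* d))
  expand = ℕ-Solver.solve-∀

2m∸2r∸1≡1+2[m∸[1+r]] : ∀ {m r} → r < m → 2 ℕ.* m ∸ 2 ℕ.* r ∸ 1 ≡ suc (2 ℕ.* (m ∸ suc r))
2m∸2r∸1≡1+2[m∸[1+r]] {r = r} r<m with ℕₚ.m≤n⇒∃[o]m+o≡n r<m
... | d , refl = trans (2[1+r+d]∸2r∸1≡1+2d r d) (cong (λ k → suc (2 ℕ.* k)) (sym (ℕₚ.m+n∸m≡n r d)))

2m∸1≡[2m∸2r∸1]+2r : ∀ {m r} → r < m → 2 ℕ.* m ∸ 1 ≡ (2 ℕ.* m ∸ 2 ℕ.* r ∸ 1) ℕ.+ 2 ℕ.* r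
2m∸1≡[2m∸2r∸1]+2r {r = r} r<m with ℕₚ.m≤n⇒∃[o]m+o≡n r<m
... | d , refl = trans (cong (_∸ 1) (expand r d)) (cong (ℕ._+ 2 ℕ.* r) (sym (2[1+r+d]∸2r∸1≡1+2d r d)))
  where
  expand : ∀ r d → 2 ℕ.* suc (r ℕ.+ d) ≡ suc (suc (2 ℕ.* d) ℕ.+ 2 ℕ.* r)
  expand = ℕ-Solver.solve-∀

m+[m∸[1+r]]≡[2m∸2r∸1]+r : ∀ {m r} → r < m → m ℕ.+ (m ∸ suc r) ≡ (2 ℕ.* m ∸ 2 ℕ.* r ∸ 1) ℕ.+ r
m+[m∸[1+r]]≡[2m∸2r∸1]+r {r = r} r<m with ℕₚ.m≤n⇒∃[o]m+o≡n r<m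
... | d , refl = begin
  suc (r ℕ.+ d) ℕ.+ (r ℕ.+ d ∸ r)               ≡⟨ cong (suc (r ℕ.+ d) ℕ.+_) (ℕₚ.m+n∸m≡n r d) ⟩
  suc (r ℕ.+ d) ℕ.+ d                           ≡⟨ regroup r d ⟩
  suc (2 ℕ.* d) ℕ.+ r                           ≡⟨ cong (ℕ._+ r) (2[1+r+d]∸2r∸1≡1+2d r d) ⟨
  (2 ℕ.* suc (r ℕ.+ d) ∸ 2 ℕ.* r ∸ 1) ℕ.+ r     ∎
  where
  regroup : ∀ r d → suc (r ℕ.+ d) ℕ.+ d ≡ suc (2 ℕ.* d) ℕ.+ r
  regroup = ℕ-Solver.solve-∀

binomial-odd : ∀ {m} → 1 ≤ m → ∀ z →
  (1ℚ - z) ^ (2 ℕ.* m ∸ 1)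
    ≡ Σ< m (λ r → ℕ→ℚ ((2 ℕ.* m ∸ 1) C r) * ((- z) ^ r * (1ℚ - z ^ (2 ℕ.* m ∸ 2 ℕ.* r ∸ 1))))
binomial-odd {m} 1≤m z = begin
  (1ℚ - z) ^ M                               ≡⟨ binomial M z ⟩
  Σ< (suc M) b                               ≡⟨ cong (λ k → Σ< k b) (1+[2m∸1]≡m+m 1≤m) ⟩
  Σ< (m ℕ.+ m) b                             ≡⟨ Σ<-fold-in-half m b ⟩
  Σ< m (λ r → b r + b (m ℕ.+ (m ∸ suc r)))   ≡⟨ Σ<-cong m paired ⟩
  Σ< m (λ r → ℕ→ℚ (M C r) * ((- z) ^ r * (1ℚ - z ^ e r))) ∎
  where
  M : ℕ
  M = 2 ℕ.* m ∸ 1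
  e : ℕ → ℕ
  e r = 2 ℕ.* m ∸ 2 ℕ.* r ∸ 1
  b : ℕ → ℚ
  b k = ℕ→ℚ (M C k) * (- z) ^ k
  paired : ∀ r → r < m → b r + b (m ℕ.+ (m ∸ suc r)) ≡ ℕ→ℚ (M C r) * ((- z) ^ r * (1ℚ - z ^ e r))
  paired r r<m = begin
    b r + b (m ℕ.+ (m ∸ suc r))                    ≡⟨ cong (λ k → b r + b k) (m+[m∸[1+r]]≡[2m∸2r∸1]+r r<m) ⟩
    b r + ℕ→ℚ (M C (e r ℕ.+ r)) * (- z) ^ (e r ℕ.+ r)
      ≡⟨ cong₂ (λ k w → b r + ℕ→ℚ k * w) M-C-symmetric (^-homo-* (- z) (e r) r) ⟩
    b r + ℕ→ℚ (M C r) * ((- z) ^ e r * (- z) ^ r)  ≡⟨ cong (λ w → b r + ℕ→ℚ (M C r) * (w * (- z) ^ r)) -z^e≡-z^e ⟩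
    b r + ℕ→ℚ (M C r) * (- (z ^ e r) * (- z) ^ r)  ≡⟨ factor (ℕ→ℚ (M C r)) ((- z) ^ r) (z ^ e r) ⟩
    ℕ→ℚ (M C r) * ((- z) ^ r * (1ℚ - z ^ e r))     ∎
    where
    M≡[e+r]+r : M ≡ (e r ℕ.+ r) ℕ.+ r
    M≡[e+r]+r = trans (2m∸1≡[2m∸2r∸1]+2r r<m) (regroup (e r) r)
      where
      regroup : ∀ e r → e ℕ.+ 2 ℕ.* r ≡ (e ℕ.+ r) ℕ.+ r
      regroup = ℕ-Solver.solve-∀
    M-C-symmetric : M C (e r ℕ.+ r) ≡ M C r
    M-C-symmetric = subst (λ n → n C (e r ℕ.+ r) ≡ n C r) (sym M≡[e+r]+r) ([a+b]Ca≡[a+b]Cb (e r ℕ.+ r) r)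
    -z^e≡-z^e : (- z) ^ e r ≡ - (z ^ e r)
    -z^e≡-z^e = subst (λ k → (- z) ^ k ≡ - (z ^ k)) (sym (2m∸2r∸1≡1+2[m∸[1+r]] r<m)) (neg-^-odd z (m ∸ suc r))
    factor : ∀ K w v → K * w + K * (- v * w) ≡ K * (w * (1ℚ - v))
    factor = solve 3 (λ K w v → K :* w :+ K :* (:- v :* w) := K :* (w :* (con 1ℚ :- v))) refl

T-suc : ∀ M n t → T M (suc n) t ≡ - (t ^ M) * T M n t + ((1ℚ - t ^ (2 ℕ.* suc n)) /' (1ℚ - t ^ 2)) ^ M
T-suc M n t = begin
  ΣFromTo 1 n (term (suc n)) + term (suc n) (suc n)   ≡⟨ cong₂ _+_ (ΣFromTo-1≡Σ< n (term (suc n))) last ⟩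
  Σ< n (λ i → term (suc n) (suc i)) + Y (suc n)       ≡⟨ cong (_+ Y (suc n)) (Σ<-cong n earlier) ⟩
  Σ< n (λ i → - (t ^ M) * term n (suc i)) + Y (suc n) ≡⟨ cong (_+ Y (suc n)) (*-distribˡ-Σ< n (- (t ^ M)) _) ⟨
  - (t ^ M) * Σ< n (λ i → term n (suc i)) + Y (suc n) ≡⟨ cong (λ s → - (t ^ M) * s + Y (suc n)) (ΣFromTo-1≡Σ< n (term n)) ⟨
  - (t ^ M) * T M n t + Y (suc n)                     ∎
  where
  Y : ℕ → ℚ
  Y k = ((1ℚ - t ^ (2 ℕ.* k)) /' (1ℚ - t ^ 2)) ^ M
  term : ℕ → ℕ → ℚ
  term n k = (- 1ℚ) ^ (n ∸ k) * Y k * t ^ (M ℕ.* (n ∸ k))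
  last : term (suc n) (suc n) ≡ Y (suc n)
  last = begin
    (- 1ℚ) ^ (n ∸ n) * Y (suc n) * t ^ (M ℕ.* (n ∸ n))  ≡⟨ cong (λ k → (- 1ℚ) ^ k * Y (suc n) * t ^ (M ℕ.* k)) (ℕₚ.n∸n≡0 n) ⟩
    1ℚ * Y (suc n) * t ^ (M ℕ.* 0)                      ≡⟨ cong (λ k → 1ℚ * Y (suc n) * t ^ k) (ℕₚ.*-zeroʳ M) ⟩
    1ℚ * Y (suc n) * 1ℚ                                 ≡⟨ ℚₚ.*-identityʳ (1ℚ * Y (suc n)) ⟩
    1ℚ * Y (suc n)                                      ≡⟨ ℚₚ.*-identityˡ (Y (suc n)) ⟩
    Y (suc n)                                           ∎
  earlier : ∀ i → i < n → term (suc n) (suc i) ≡ - (t ^ M) * term n (suc i)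
  earlier i i<n = begin
    (- 1ℚ) ^ (n ∸ i) * Y (suc i) * t ^ (M ℕ.* (n ∸ i))
      ≡⟨ cong (λ k → (- 1ℚ) ^ k * Y (suc i) * t ^ (M ℕ.* k)) (ℕₚ.+-∸-assoc 1 i<n) ⟩
    (- 1ℚ) ^ suc j * Y (suc i) * t ^ (M ℕ.* suc j)
      ≡⟨ cong (λ w → (- 1ℚ) ^ suc j * Y (suc i) * w) (trans (cong (t ^_) (ℕₚ.*-suc M j)) (^-homo-* t M (M ℕ.* j))) ⟩
    - 1ℚ * (- 1ℚ) ^ j * Y (suc i) * (t ^ M * t ^ (M ℕ.* j))
      ≡⟨ shift ((- 1ℚ) ^ j) (Y (suc i)) (t ^ M) (t ^ (M ℕ.* j)) ⟩
    - (t ^ M) * term n (suc i)                          ∎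
    where
    j = n ∸ suc i
    shift : ∀ σ y p q → - 1ℚ * σ * y * (p * q) ≡ - p * (σ * y * q)
    shift = solve 4 (λ σ y p q → :- con 1ℚ :* σ :* y :* (p :* q) := :- p :* (σ :* y :* q)) refl

numerator : ℕ → ℚ → ℚ → ℚ
numerator n u a = a ^ n * (1ℚ - u ^ (2 ℕ.* n ℕ.+ 1) - (- u) ^ n * (1ℚ - u))

numerator-zero : ∀ u a → numerator 0 u a ≡ 0ℚ
numerator-zero u a = vanish u
  where
  vanish : ∀ u → 1ℚ * (1ℚ - u * 1ℚ - 1ℚ * (1ℚ - u)) ≡ 0ℚ
  vanish = solve 1 (λ u → con 1ℚ :* (con 1ℚ :- u :* con 1ℚ :- con 1ℚ :* (con 1ℚ :- u)) := con 0ℚ) refl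

numerator-suc : ∀ n u a →
  numerator (suc n) u a ≡ (1ℚ + u) * a ^ suc n * (1ℚ - u ^ (2 ℕ.* suc n)) - u * a * numerator n u a
numerator-suc n u a = begin
  a ^ suc n * (1ℚ - u ^ (2 ℕ.* suc n ℕ.+ 1) - (- u) ^ suc n * (1ℚ - u))
    ≡⟨ cong (λ w → a ^ suc n * (1ℚ - w - (- u) ^ suc n * (1ℚ - u))) u^[2n+3] ⟩
  a * a ^ n * (1ℚ - u * (u * (u * u ^ (2 ℕ.* n))) - - u * (- u) ^ n * (1ℚ - u))
    ≡⟨ recurrence u a (a ^ n) (u ^ (2 ℕ.* n)) ((- u) ^ n) ⟩
  (1ℚ + u) * (a * a ^ n) * (1ℚ - u * (u * u ^ (2 ℕ.* n)))
    - u * a * (a ^ n * (1ℚ - u * u ^ (2 ℕ.* n) - (- u) ^ n * (1ℚ - u)))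
    ≡⟨ cong₂ (λ v w → (1ℚ + u) * a ^ suc n * (1ℚ - v) - u * a * (a ^ n * (1ℚ - w - (- u) ^ n * (1ℚ - u))))
             (^-2[1+n] u n) (^-2n+1 u n) ⟨
  (1ℚ + u) * a ^ suc n * (1ℚ - u ^ (2 ℕ.* suc n)) - u * a * numerator n u a
    ∎
  where
  u^[2n+3] : u ^ (2 ℕ.* suc n ℕ.+ 1) ≡ u * (u * (u * u ^ (2 ℕ.* n)))
  u^[2n+3] = trans (^-2n+1 u (suc n)) (cong (u *_) (^-2[1+n] u n))
  recurrence : ∀ u a A V W →
    a * A * (1ℚ - u * (u * (u * V)) - - u * W * (1ℚ - u))
      ≡ (1ℚ + u) * (a * A) * (1ℚ - u * (u * V)) - u * a * (A * (1ℚ - u * V - W * (1ℚ - u)))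
  recurrence = solve 5 (λ u a A V W →
      a :* A :* (con 1ℚ :- u :* (u :* (u :* V)) :- :- u :* W :* (con 1ℚ :- u))
        := (con 1ℚ :+ u) :* (a :* A) :* (con 1ℚ :- u :* (u :* V))
           :- u :* a :* (A :* (con 1ℚ :- u :* V :- W :* (con 1ℚ :- u)))) refl

summand-pair≡numerator : ∀ (t K Δ : ℚ) (e r n : ℕ) {M} → M ≡ e ℕ.+ 2 ℕ.* r →
    (- 1ℚ) ^ (n ℕ.+ r ℕ.+ 1) * K * (((1ℚ - t ^ e) * t ^ (M ℕ.* n)) /' (Δ * (1ℚ + t ^ e)))
  + (- 1ℚ) ^ r * K * (((1ℚ - t ^ ((2 ℕ.* n ℕ.+ 1) ℕ.* e)) * t ^ (2 ℕ.* r ℕ.* n)) /' (Δ * (1ℚ + t ^ e)))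
  ≡ (- 1ℚ) ^ r * K * recip (Δ * (1ℚ + t ^ e)) * numerator n (t ^ e) (t ^ (2 ℕ.* r))
summand-pair≡numerator t K Δ e r n refl = begin
  _ ≡⟨ cong₂ (λ x y → (- 1ℚ) ^ (n ℕ.+ r ℕ.+ 1) * K * x + σ * K * y) (/'-≡-*-recip _ D) (/'-≡-*-recip _ D) ⟩
  shape ((- 1ℚ) ^ (n ℕ.+ r ℕ.+ 1)) (t ^ ((e ℕ.+ 2 ℕ.* r) ℕ.* n)) (t ^ ((2 ℕ.* n ℕ.+ 1) ℕ.* e)) (t ^ (2 ℕ.* r ℕ.* n))
    ≡⟨ cong₂ (λ x y → shape x y (t ^ ((2 ℕ.* n ℕ.+ 1) ℕ.* e)) (t ^ (2 ℕ.* r ℕ.* n))) sign t^Mn ⟩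
  shape (σ * (- 1ℚ * (- 1ℚ) ^ n)) (u ^ n * a ^ n) (t ^ ((2 ℕ.* n ℕ.+ 1) ℕ.* e)) (t ^ (2 ℕ.* r ℕ.* n))
    ≡⟨ cong₂ (shape (σ * (- 1ℚ * (- 1ℚ) ^ n)) (u ^ n * a ^ n)) t^[2n+1]e (sym (^-assocʳ t (2 ℕ.* r) n)) ⟩
  shape (σ * (- 1ℚ * (- 1ℚ) ^ n)) (u ^ n * a ^ n) (u * u ^ (2 ℕ.* n)) (a ^ n)
    ≡⟨ collect σ ((- 1ℚ) ^ n) K (recip D) u (u ^ n) (a ^ n) (u ^ (2 ℕ.* n)) ⟩
  σ * K * recip D * (a ^ n * (1ℚ - u * u ^ (2 ℕ.* n) - (- 1ℚ) ^ n * u ^ n * (1ℚ - u)))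
    ≡⟨ cong₂ (λ v w → σ * K * recip D * (a ^ n * (1ℚ - v - w * (1ℚ - u)))) (^-2n+1 u n) (neg-^ u n) ⟨
  σ * K * recip D * numerator n u a ∎
  where
  u a σ D : ℚ
  u = t ^ e
  a = t ^ (2 ℕ.* r)
  σ = (- 1ℚ) ^ r
  D = Δ * (1ℚ + u)
  shape : ℚ → ℚ → ℚ → ℚ → ℚ
  shape σ′ p q s = σ′ * K * ((1ℚ - u) * p * recip D) + σ * K * ((1ℚ - q) * s * recip D)
  sign : (- 1ℚ) ^ (n ℕ.+ r ℕ.+ 1) ≡ σ * (- 1ℚ * (- 1ℚ) ^ n)
  sign = trans (cong ((- 1ℚ) ^_) (reorder n r)) (^-homo-* (- 1ℚ) r (suc n))
    where
    reorder : ∀ n r → n ℕ.+ r ℕ.+ 1 ≡ r ℕ.+ suc n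
    reorder = ℕ-Solver.solve-∀
  t^Mn : t ^ ((e ℕ.+ 2 ℕ.* r) ℕ.* n) ≡ u ^ n * a ^ n
  t^Mn = begin
    t ^ ((e ℕ.+ 2 ℕ.* r) ℕ.* n)         ≡⟨ cong (t ^_) (ℕₚ.*-distribʳ-+ n e (2 ℕ.* r)) ⟩
    t ^ (e ℕ.* n ℕ.+ 2 ℕ.* r ℕ.* n)     ≡⟨ ^-homo-* t (e ℕ.* n) (2 ℕ.* r ℕ.* n) ⟩
    t ^ (e ℕ.* n) * t ^ (2 ℕ.* r ℕ.* n) ≡⟨ cong₂ _*_ (^-assocʳ t e n) (^-assocʳ t (2 ℕ.* r) n) ⟨
    u ^ n * a ^ n                       ∎
  t^[2n+1]e : t ^ ((2 ℕ.* n ℕ.+ 1) ℕ.* e) ≡ u * u ^ (2 ℕ.* n)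
  t^[2n+1]e = begin
    t ^ ((2 ℕ.* n ℕ.+ 1) ℕ.* e)  ≡⟨ cong (t ^_) (ℕₚ.*-comm (2 ℕ.* n ℕ.+ 1) e) ⟩
    t ^ (e ℕ.* (2 ℕ.* n ℕ.+ 1))  ≡⟨ ^-assocʳ t e (2 ℕ.* n ℕ.+ 1) ⟨
    u ^ (2 ℕ.* n ℕ.+ 1)          ≡⟨ ^-2n+1 u n ⟩
    u * u ^ (2 ℕ.* n)            ∎
  collect : ∀ σ τ K ρ u U A V →
    σ * (- 1ℚ * τ) * K * ((1ℚ - u) * (U * A) * ρ) + σ * K * ((1ℚ - u * V) * A * ρ)
      ≡ σ * K * ρ * (A * (1ℚ - u * V - τ * U * (1ℚ - u)))
  collect = solve 8 (λ σ τ K ρ u U A V →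
      σ :* (:- con 1ℚ :* τ) :* K :* ((con 1ℚ :- u) :* (U :* A) :* ρ) :+ σ :* K :* ((con 1ℚ :- u :* V) :* A :* ρ)
        := σ :* K :* ρ :* (A :* (con 1ℚ :- u :* V :- τ :* U :* (con 1ℚ :- u)))) refl

weighted-numerator-suc : ∀ (t K γ j : ℚ) (e r n : ℕ) → (1ℚ + t ^ e) * j ≡ 1ℚ →
  let u = t ^ e; a = t ^ (2 ℕ.* r); z = t ^ (2 ℕ.* suc n); σ = (- 1ℚ) ^ r in
  σ * K * (γ * j) * numerator (suc n) u a
    ≡ - (t ^ (e ℕ.+ 2 ℕ.* r)) * (σ * K * (γ * j) * numerator n u a) + γ * (K * ((- z) ^ r * (1ℚ - z ^ e)))
weighted-numerator-suc t K γ j e r n [1+u]j≡1 = begin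
  κ * numerator (suc n) u a
    ≡⟨ cong (κ *_) (numerator-suc n u a) ⟩
  κ * ((1ℚ + u) * a ^ suc n * (1ℚ - W) - u * a * numerator n u a)
    ≡⟨ expand σ K γ j u a (a ^ suc n) W (numerator n u a) ⟩
  - (u * a) * (κ * numerator n u a) + γ * (K * P) * ((1ℚ + u) * j)
    ≡⟨ cong (λ x → - (u * a) * (κ * numerator n u a) + γ * (K * P) * x) [1+u]j≡1 ⟩
  - (u * a) * (κ * numerator n u a) + γ * (K * P) * 1ℚ
    ≡⟨ cong (- (u * a) * (κ * numerator n u a) +_) (ℚₚ.*-identityʳ (γ * (K * P))) ⟩
  - (u * a) * (κ * numerator n u a) + γ * (K * P)
    ≡⟨ cong₂ (λ p w → - p * (κ * numerator n u a) + γ * (K * w)) (^-homo-* t e (2 ℕ.* r)) binomial-pair ⟨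
  - (t ^ (e ℕ.+ 2 ℕ.* r)) * (κ * numerator n u a) + γ * (K * ((- z) ^ r * (1ℚ - z ^ e)))
    ∎
  where
  u a z σ κ W P : ℚ
  u = t ^ e
  a = t ^ (2 ℕ.* r)
  z = t ^ (2 ℕ.* suc n)
  σ = (- 1ℚ) ^ r
  κ = σ * K * (γ * j)
  W = u ^ (2 ℕ.* suc n)
  P = σ * a ^ suc n * (1ℚ - W)
  z^k≡t^[2k[1+n]] : ∀ k → z ^ k ≡ (t ^ k) ^ (2 ℕ.* suc n)
  z^k≡t^[2k[1+n]] k = begin
    z ^ k                        ≡⟨ ^-assocʳ t (2 ℕ.* suc n) k ⟩
    t ^ (2 ℕ.* suc n ℕ.* k)      ≡⟨ cong (t ^_) (ℕₚ.*-comm (2 ℕ.* suc n) k) ⟩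
    t ^ (k ℕ.* (2 ℕ.* suc n))    ≡⟨ ^-assocʳ t k (2 ℕ.* suc n) ⟨
    (t ^ k) ^ (2 ℕ.* suc n)      ∎
  a^[1+n] : z ^ r ≡ a ^ suc n
  a^[1+n] = begin
    z ^ r                        ≡⟨ z^k≡t^[2k[1+n]] r ⟩
    (t ^ r) ^ (2 ℕ.* suc n)      ≡⟨ ^-assocʳ (t ^ r) 2 (suc n) ⟨
    ((t ^ r) ^ 2) ^ suc n        ≡⟨ cong (_^ suc n) (trans (^-assocʳ t r 2) (cong (t ^_) (ℕₚ.*-comm r 2))) ⟩
    a ^ suc n                    ∎
  binomial-pair : (- z) ^ r * (1ℚ - z ^ e) ≡ P
  binomial-pair = cong₂ (λ v w → v * (1ℚ - w)) (trans (neg-^ z r) (cong (σ *_) a^[1+n])) (z^k≡t^[2k[1+n]] e)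
  expand : ∀ σ K γ j u a A W N →
    σ * K * (γ * j) * ((1ℚ + u) * A * (1ℚ - W) - u * a * N)
      ≡ - (u * a) * (σ * K * (γ * j) * N) + γ * (K * (σ * A * (1ℚ - W))) * ((1ℚ + u) * j)
  expand = solve 9 (λ σ K γ j u a A W N →
      σ :* K :* (γ :* j) :* ((con 1ℚ :+ u) :* A :* (con 1ℚ :- W) :- u :* a :* N)
        := :- (u :* a) :* (σ :* K :* (γ :* j) :* N) :+ γ :* (K :* (σ :* A :* (con 1ℚ :- W))) :* ((con 1ℚ :+ u) :* j)) refl

module _ (m : ℕ) (t : ℚ) where

  private
    M : ℕ
    M = 2 ℕ.* m ∸ 1
    e : ℕ → ℕ
    e r = 2 ℕ.* m ∸ 2 ℕ.* r ∸ 1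
    binom : ℕ → ℚ
    binom r = ℕ→ℚ (M C r)
    c : ℚ
    c = recip (1ℚ - t ^ 2)
    weight : ℕ → ℚ
    weight r = (- 1ℚ) ^ r * binom r * (c ^ M * recip (1ℚ + t ^ e r))
    binomialPair : ℚ → ℕ → ℚ
    binomialPair z r = binom r * ((- z) ^ r * (1ℚ - z ^ e r))

  rhs₁ rhs₂ summand : ℕ → ℕ → ℚ
  rhs₁ n r = (- 1ℚ) ^ (n ℕ.+ r ℕ.+ 1) * binom r
    * (((1ℚ - t ^ e r) * t ^ (M ℕ.* n)) /' ((1ℚ - t ^ 2) ^ M * (1ℚ + t ^ e r)))
  rhs₂ n r = (- 1ℚ) ^ r * binom r
    * (((1ℚ - t ^ ((2 ℕ.* n ℕ.+ 1) ℕ.* e r)) * t ^ (2 ℕ.* r ℕ.* n)) /' ((1ℚ - t ^ 2) ^ M * (1ℚ + t ^ e r)))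
  summand n r = weight r * numerator n (t ^ e r) (t ^ (2 ℕ.* r))

  module _ (1-t²≢0 : 1ℚ - t ^ 2 ≢ 0ℚ) (1+tᵉ≢0 : ∀ r → r < m → 1ℚ + t ^ e r ≢ 0ℚ) where

    rhs≡summand : ∀ n r → r < m → rhs₁ n r + rhs₂ n r ≡ summand n r
    rhs≡summand n r r<m = begin
      rhs₁ n r + rhs₂ n r
        ≡⟨ summand-pair≡numerator t (binom r) ((1ℚ - t ^ 2) ^ M) (e r) r n (2m∸1≡[2m∸2r∸1]+2r r<m) ⟩
      (- 1ℚ) ^ r * binom r * recip ((1ℚ - t ^ 2) ^ M * (1ℚ + t ^ e r)) * numerator n (t ^ e r) (t ^ (2 ℕ.* r))
        ≡⟨ cong (λ x → (- 1ℚ) ^ r * binom r * x * numerator n (t ^ e r) (t ^ (2 ℕ.* r)))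
                (recip-^-* (1ℚ - t ^ 2) (1ℚ + t ^ e r) M 1-t²≢0 (1+tᵉ≢0 r r<m)) ⟩
      summand n r ∎

    rhs≡Σsummand : 1 ≤ m → ∀ n → ΣFromTo 0 (m ∸ 1) (rhs₁ n) + ΣFromTo 0 (m ∸ 1) (rhs₂ n) ≡ Σ< m (summand n)
    rhs≡Σsummand 1≤m n = begin
      ΣFromTo 0 (m ∸ 1) (rhs₁ n) + ΣFromTo 0 (m ∸ 1) (rhs₂ n)
        ≡⟨ cong₂ _+_ (ΣFromTo-0≡Σ< 1≤m (rhs₁ n)) (ΣFromTo-0≡Σ< 1≤m (rhs₂ n)) ⟩
      Σ< m (rhs₁ n) + Σ< m (rhs₂ n)     ≡⟨ Σ<-distrib-+ m (rhs₁ n) (rhs₂ n) ⟨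
      Σ< m (λ r → rhs₁ n r + rhs₂ n r)  ≡⟨ Σ<-cong m (rhs≡summand n) ⟩
      Σ< m (summand n)                  ∎

    summand-suc : ∀ n r → r < m → summand (suc n) r ≡ - (t ^ M) * summand n r + c ^ M * binomialPair (t ^ (2 ℕ.* suc n)) r
    summand-suc n r r<m =
      trans (weighted-numerator-suc t (binom r) (c ^ M) (recip (1ℚ + t ^ e r)) (e r) r n
               (*-recip (1ℚ + t ^ e r) (1+tᵉ≢0 r r<m)))
            (cong (λ k → - (t ^ k) * summand n r + c ^ M * binomialPair (t ^ (2 ℕ.* suc n)) r)
                  (sym (2m∸1≡[2m∸2r∸1]+2r r<m)))

    T≡Σsummand : 1 ≤ m → ∀ n → T M n t ≡ Σ< m (summand n)
    T≡Σsummand 1≤m zero = sym (trans (Σ<-cong m (λ r _ → vanish r)) (Σ<-0 m))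
      where
      vanish : ∀ r → summand 0 r ≡ 0ℚ
      vanish r = trans (cong (weight r *_) (numerator-zero (t ^ e r) (t ^ (2 ℕ.* r)))) (ℚₚ.*-zeroʳ (weight r))
    T≡Σsummand 1≤m (suc n) = begin
      T M (suc n) t                                            ≡⟨ T-suc M n t ⟩
      - (t ^ M) * T M n t + ((1ℚ - z) /' (1ℚ - t ^ 2)) ^ M
        ≡⟨ cong₂ (λ x y → - (t ^ M) * x + y) (T≡Σsummand 1≤m n) inhomogeneous ⟩
      - (t ^ M) * Σ< m (summand n) + c ^ M * Σ< m (binomialPair z)
        ≡⟨ cong₂ _+_ (*-distribˡ-Σ< m (- (t ^ M)) (summand n)) (*-distribˡ-Σ< m (c ^ M) (binomialPair z)) ⟩
      Σ< m (λ r → - (t ^ M) * summand n r) + Σ< m (λ r → c ^ M * binomialPair z r)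
        ≡⟨ Σ<-distrib-+ m (λ r → - (t ^ M) * summand n r) (λ r → c ^ M * binomialPair z r) ⟨
      Σ< m (λ r → - (t ^ M) * summand n r + c ^ M * binomialPair z r)
        ≡⟨ Σ<-cong m (λ r r<m → sym (summand-suc n r r<m)) ⟩
      Σ< m (summand (suc n))                                   ∎
      where
      z : ℚ
      z = t ^ (2 ℕ.* suc n)
      inhomogeneous : ((1ℚ - z) /' (1ℚ - t ^ 2)) ^ M ≡ c ^ M * Σ< m (binomialPair z)
      inhomogeneous = begin
        ((1ℚ - z) /' (1ℚ - t ^ 2)) ^ M  ≡⟨ cong (_^ M) (/'-≡-*-recip (1ℚ - z) (1ℚ - t ^ 2)) ⟩
        ((1ℚ - z) * c) ^ M              ≡⟨ ^-distrib-* (1ℚ - z) c M ⟩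
        (1ℚ - z) ^ M * c ^ M            ≡⟨ ℚₚ.*-comm ((1ℚ - z) ^ M) (c ^ M) ⟩
        c ^ M * (1ℚ - z) ^ M            ≡⟨ cong (c ^ M *_) (binomial-odd 1≤m z) ⟩
        c ^ M * Σ< m (binomialPair z)   ∎

lemma2p3 : (m n : ℕ) → m ≥ 1 → n ≥ 1 → (t : ℚ)
    → 1ℚ - t ^ 2 ≢ 0ℚ
    → (∀ r → r < m → 1ℚ + t ^ (2 ℕ.* m ∸ 2 ℕ.* r ∸ 1) ≢ 0ℚ)
    → T (2 ℕ.* m ∸ 1) n t
      ≡ ΣFromTo 0 (m ∸ 1) (λ r →
            (- 1ℚ) ^ (n ℕ.+ r ℕ.+ 1) * ℕ→ℚ ((2 ℕ.* m ∸ 1) C r)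
              * (((1ℚ - t ^ (2 ℕ.* m ∸ 2 ℕ.* r ∸ 1)) * t ^ ((2 ℕ.* m ∸ 1) ℕ.* n))
                 /' ((1ℚ - t ^ 2) ^ (2 ℕ.* m ∸ 1) * (1ℚ + t ^ (2 ℕ.* m ∸ 2 ℕ.* r ∸ 1)))))
        + ΣFromTo 0 (m ∸ 1) (λ r →
            (- 1ℚ) ^ r * ℕ→ℚ ((2 ℕ.* m ∸ 1) C r)
              * (((1ℚ - t ^ ((2 ℕ.* n ℕ.+ 1) ℕ.* (2 ℕ.* m ∸ 2 ℕ.* r ∸ 1))) * t ^ (2 ℕ.* r ℕ.* n))
                 /' ((1ℚ - t ^ 2) ^ (2 ℕ.* m ∸ 1) * (1ℚ + t ^ (2 ℕ.* m ∸ 2 ℕ.* r ∸ 1)))))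
lemma2p3 m n 1≤m _ t 1-t²≢0 1+tᵉ≢0 = begin
  T (2 ℕ.* m ∸ 1) n t                ≡⟨ T≡Σsummand m t 1-t²≢0 1+tᵉ≢0 1≤m n ⟩
  Σ< m (summand m t n)               ≡⟨ rhs≡Σsummand m t 1-t²≢0 1+tᵉ≢0 1≤m n ⟨
  ΣFromTo 0 (m ∸ 1) (rhs₁ m t n) + ΣFromTo 0 (m ∸ 1) (rhs₂ m t n) ∎
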